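{- Every Fano plane admits exactly eight distinct orientations.
   Context: A Fano plane is a pair $(\mathcal{V},\mathcal{B})$ with $|\mathcal{V}|=7$ and $\mathcal{B}$ a collection of 3-subsets (blocks) such that every 2-subset of $\mathcal{V}$ lies in exactly one block. An orientation on $(\mathcal{V},\mathcal{B})$ is an antisymmetric binary relation $\rightarrow$ on $\mathcal{V}$ such that (i) for every block $\{x_1,x_2,x_3\}$, either $x_1\rightarrow x_2\rightarrow x_3\rightarrow x_1$ or $x_1\rightarrow x_3\rightarrow x_2\rightarrow x_1$; (ii) for every $x\in\mathcal{V}$, if $\{x,y_1,z_1\},\{x,y_2,z_2\},\{x,y_3,z_3\}$ are the three blocks through $x$ and $x\rightarrow y_1$, $x\rightarrow y_2$, $x\rightarrow y_3$, then $\{y_1,y_2,y_3\}\in\mathcal{B}$. -}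

module Defs where

open import Data.Nat using (ℕ)
open import Data.Bool using (Bool; true)
open import Data.Fin using (Fin)
open import Data.Fin.Subset using (Subset; _∈_; ∣_∣; ⁅_⁆; _∪_)
open import Data.Product using (Σ; _×_; ∃)
open import Data.Sum using (_⊎_)
open import Relation.Binary.PropositionalEquality using (_≡_; _≢_)
open import Relation.Nullary using (¬_)

-- Point set: the 7 points are Fin 7 (any 7-element set is in bijection with it).
Point : Set
Point = Fin 7

Blocks : Set₁
Blocks = Subset 7 → Set

record IsFanoPlane (B : Blocks) : Set where
  field
    blockSize : ∀ b → B b → ∣ b ∣ ≡ 3
    uniqueBlock : ∀ (x y : Point) → x ≢ y →
      Σ (Subset 7) λ b → B b × x ∈ b × y ∈ b ×
        (∀ b′ → B b′ → x ∈ b′ → y ∈ b′ → b′ ≡ b)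

Relation : Set
Relation = Point → Point → Bool

_⟶[_]_ : Point → Relation → Point → Set
x ⟶[ R ] y = R x y ≡ true

record IsOrientation (B : Blocks) (R : Relation) : Set where
  field
    antisym : ∀ x y → x ⟶[ R ] y → ¬ (y ⟶[ R ] x)
    cyclic : ∀ b → B b → ∀ x₁ x₂ x₃ → x₁ ∈ b → x₂ ∈ b → x₃ ∈ b →
      x₁ ≢ x₂ → x₂ ≢ x₃ → x₁ ≢ x₃ →
      (x₁ ⟶[ R ] x₂ × x₂ ⟶[ R ] x₃ × x₃ ⟶[ R ] x₁) ⊎
      (x₁ ⟶[ R ] x₃ × x₃ ⟶[ R ] x₂ × x₂ ⟶[ R ] x₁)
    outBlock : ∀ x y₁ y₂ y₃ b₁ b₂ b₃ →
      B b₁ → B b₂ → B b₃ →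
      x ∈ b₁ → x ∈ b₂ → x ∈ b₃ →
      b₁ ≢ b₂ → b₂ ≢ b₃ → b₁ ≢ b₃ →
      y₁ ∈ b₁ → y₂ ∈ b₂ → y₃ ∈ b₃ →
      x ⟶[ R ] y₁ → x ⟶[ R ] y₂ → x ⟶[ R ] y₃ →
      B (⁅ y₁ ⁆ ∪ ⁅ y₂ ⁆ ∪ ⁅ y₃ ⁆)

_≐_ : Relation → Relation → Set
R ≐ S = ∀ x y → R x y ≡ S x y

{-# OPTIONS --safe #-}
module Submission where

-- Joining two points of a Fano plane by their line gives a Steiner quasigroup on the seven
-- points (x · y is the third point of the line through x and y), and the orientations of the
-- plane are exactly the orientations of this quasigroup.  All Steiner quasigroups on seven
-- points are isomorphic: relabel so that 0 · 1 = 2, 0 · 3 = 4 and 1 · 3 = 5; then each of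
-- the four remaining lines is forced, because every other candidate for its third point
-- already lies on a known line with one of its points.  So it suffices to count the
-- orientations of the model 𝔽₂³ ∖ {0} with x · y = x + y.  An orientation of the model is
-- determined by the cyclic order it gives each of the seven lines, and checking all 2⁷
-- choices leaves exactly eight.

open import Defs
open import Algebra.Core using (Op₂)
open import Data.Bool using (Bool; true; false; _xor_)
import Data.Bool.Properties as Bool
open import Data.Empty using (⊥; ⊥-elim)
open import Data.Fin using (Fin; punchOut)
open import Data.Fin.Patterns
open import Data.Fin.Permutation
  using (Permutation′; permutation; _⟨$⟩ʳ_; _⟨$⟩ˡ_; inverseˡ; inverseʳ; flip)
open import Data.Fin.Properties using (_≟_; all?; any?; pigeonhole; punchOut-injective; <⇒≢)
open import Data.Fin.Subset using (Subset; _∈_; ∣_∣; ⁅_⁆; _∪_)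
open import Data.Fin.Subset.Properties
  using (_∈?_; anySubset?; x∈⁅x⁆; x∈⁅y⁆⇒x≡y; x∈p∪q⁻; x∈p∪q⁺)
open import Data.List using (List; []; _∷_)
open import Data.List.Relation.Unary.All using (All; []; _∷_; lookupWith)
open import Data.List.Relation.Unary.Any using (Any)
import Data.List.Relation.Unary.Any as Any
open import Data.Nat using (ℕ; suc)
import Data.Nat.Properties as ℕ
open import Data.Product using (Σ; _×_; ∃; _,_; proj₁; proj₂)
open import Data.Product.Properties using (≡-dec)
open import Data.Sum using (_⊎_; inj₁; inj₂)
import Data.Sum as Sum
open import Data.Vec using (Vec; []; _∷_; lookup; tabulate)
import Data.Vec.Properties as Vec
open import Data.Vec.Relation.Unary.All using ([]; _∷_)
open import Data.Vec.Relation.Unary.AllPairs using ([]; _∷_)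
open import Data.Vec.Relation.Unary.Unique.Propositional using (Unique)
open import Data.Vec.Relation.Unary.Unique.Propositional.Properties using (lookup-injective)
open import Function using (_∘_; _⇔_; mk⇔; Equivalence)
open import Function.Definitions using (Injective)
open import Relation.Binary.Definitions using (DecidableEquality)
open import Relation.Binary.PropositionalEquality
open import Relation.Nullary
open import Relation.Nullary.Decidable
  using (toSum; from-yes; map′; decidable-stable; _→-dec_; _×-dec_; _⊎-dec_; ¬?)

injective⇒surjective : ∀ {n} (f : Fin n → Fin n) → Injective _≡_ _≡_ f →
                       ∀ y → ∃ λ i → f i ≡ y
injective⇒surjective {suc m} f f-injective y with any? (λ i → f i ≟ y)
... | yes found = found
... | no ∄ =
  let i , j , i<j , fᵢ≡fⱼ = pigeonhole (ℕ.n<1+n m) (λ k → punchOut (y≢f k)) in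
  contradiction (f-injective (punchOut-injective (y≢f i) (y≢f j) fᵢ≡fⱼ)) (<⇒≢ i<j)
  where
    y≢f : ∀ k → y ≢ f k
    y≢f k y≡fk = ∄ (k , sym y≡fk)

injective⇒permutation : ∀ {n} (f : Fin n → Fin n) → Injective _≡_ _≡_ f → Permutation′ n
injective⇒permutation f f-injective = permutation f (proj₁ ∘ surjective) (proj₂ ∘ surjective)
  (λ i → f-injective (proj₂ (surjective (f i))))
  where
    surjective : ∀ y → ∃ λ i → f i ≡ y
    surjective = injective⇒surjective f f-injective

all-subsets? : ∀ {n} {P : Subset n → Set} → (∀ p → Dec (P p)) → Dec (∀ p → P p)
all-subsets? P? = map′ (λ ∄¬P p → decidable-stable (P? p) (∄¬P ∘ (p ,_)))
                       (λ ∀P (p , ¬Pp) → ¬Pp (∀P p))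
                       (¬? (anySubset? (¬? ∘ P?)))

Triple : Set
Triple = Point × Point × Point

_≟₃_ : DecidableEquality Triple
_≟₃_ = ≡-dec _≟_ (≡-dec _≟_ _≟_)

reverse : Triple → Triple
reverse (a , b , c) = b , a , c

data Rotation : Triple → Triple → Set where
  rot₀ : ∀ {a b c} → Rotation (a , b , c) (a , b , c)
  rot₁ : ∀ {a b c} → Rotation (a , b , c) (b , c , a)
  rot₂ : ∀ {a b c} → Rotation (a , b , c) (c , a , b)

rotation? : ∀ ℓ t → Dec (Rotation ℓ t)
rotation? (a , b , c) t with t ≟₃ (a , b , c) | t ≟₃ (b , c , a) | t ≟₃ (c , a , b)
... | yes refl | _        | _        = yes rot₀
... | no _     | yes refl | _        = yes rot₁
... | no _     | no _     | yes refl = yes rot₂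
... | no ≢₀    | no ≢₁    | no ≢₂    =
  no λ { rot₀ → ≢₀ refl ; rot₁ → ≢₁ refl ; rot₂ → ≢₂ refl }

rotation-reverse : ∀ {ℓ t} → Rotation (reverse ℓ) t → Rotation ℓ (reverse t)
rotation-reverse rot₀ = rot₀
rotation-reverse rot₁ = rot₂
rotation-reverse rot₂ = rot₁

Ordering : Triple → Triple → Set
Ordering ℓ t = Rotation ℓ t ⊎ Rotation (reverse ℓ) t

ordering? : ∀ ℓ t → Dec (Ordering ℓ t)
ordering? ℓ t = rotation? ℓ t ⊎-dec rotation? (reverse ℓ) t

orient : Bool → Triple → Triple
orient true  ℓ = ℓ
orient false ℓ = reverse ℓ

ordering-orient : ∀ s {ℓ t} → Ordering ℓ t → Ordering (orient s ℓ) t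
ordering-orient true  o = o
ordering-orient false o = Sum.swap o

-- Steiner quasigroups

Closed : Op₂ Point → Triple → Set
Closed _·_ (a , b , c) = a · b ≡ c

Excluded : List Triple → Point → Point → Point → Set
Excluded known x y w = Any (λ ℓ → ∃ λ k → k ≢ y × Ordering ℓ (x , w , k)) known

excluded? : ∀ known x y w → Dec (Excluded known x y w)
excluded? known x y w = Any.any? (λ ℓ → any? λ k → ¬? (k ≟ y) ×-dec ordering? ℓ (x , w , k)) known

record IsSteiner (_·_ : Op₂ Point) : Set where
  field
    idem       : ∀ x → x · x ≡ x
    comm       : ∀ x y → x · y ≡ y · x
    involutive : ∀ x y → x · (x · y) ≡ y

  exchange : ∀ {x y z} → x · y ≡ z → x · z ≡ y
  exchange {x} {y} refl = involutive x y

  exchange-≢ : ∀ {x y w k} → x · y ≡ k → w ≢ k → x · w ≢ y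
  exchange-≢ x·y≡k w≢k x·w≡y = w≢k (trans (sym (exchange x·w≡y)) x·y≡k)

  ·-≢ˡ : ∀ {x y} → x ≢ y → x · y ≢ x
  ·-≢ˡ {x} {y} x≢y x·y≡x = x≢y (trans (sym (idem x)) (exchange x·y≡x))

  ·-≢ʳ : ∀ {x y} → x ≢ y → x · y ≢ y
  ·-≢ʳ {x} {y} x≢y x·y≡y = ·-≢ˡ (x≢y ∘ sym) (trans (comm y x) x·y≡y)

  ·-cancelʳ : ∀ {x y z} → x · z ≡ y · z → x ≡ y
  ·-cancelʳ {x} {y} {z} eq = begin
    x           ≡⟨ sym (involutive z x) ⟩
    z · (z · x) ≡⟨ cong (z ·_) (trans (comm z x) (trans eq (comm y z))) ⟩
    z · (z · y) ≡⟨ involutive z y ⟩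
    y           ∎
    where open ≡-Reasoning

  closed-rotation : ∀ {ℓ t} → Closed _·_ ℓ → Rotation ℓ t → Closed _·_ t
  closed-rotation ab≡c rot₀ = ab≡c
  closed-rotation {b , _} ab≡c rot₁ = exchange (trans (comm _ b) ab≡c)
  closed-rotation {a , _} ab≡c rot₂ = trans (comm _ a) (exchange ab≡c)

  closed-ordering : ∀ {ℓ t} → Closed _·_ ℓ → Ordering ℓ t → Closed _·_ t
  closed-ordering ab≡c (inj₁ r) = closed-rotation ab≡c r
  closed-ordering {a , b , _} ab≡c (inj₂ r) = closed-rotation (trans (comm b a) ab≡c) r

  third-by-elimination : ∀ {known x y z} → All (Closed _·_) known → x ≢ y →
                         (∀ w → w ≢ z → w ≢ x → w ≢ y → Excluded known x y w) → x · y ≡ z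
  third-by-elimination {x = x} {y} {z} known-closed x≢y excluded with x · y ≟ z
  ... | yes x·y≡z = x·y≡z
  ... | no x·y≢z  =
    ⊥-elim (lookupWith absurd known-closed (excluded (x · y) x·y≢z (·-≢ˡ x≢y) (·-≢ʳ x≢y)))
    where
      absurd : ∀ {ℓ} → Closed _·_ ℓ → ∃ (λ k → k ≢ y × Ordering ℓ (x , x · y , k)) → ⊥
      absurd ℓ-closed (k , k≢y , o) = k≢y (trans (sym (closed-ordering ℓ-closed o)) (involutive x y))

-- Orientations

Cyclic : Relation → Triple → Set
Cyclic R (a , b , c) = a ⟶[ R ] b × b ⟶[ R ] c × c ⟶[ R ] a

cyclic-rotation : ∀ {R ℓ t} → Cyclic R ℓ → Rotation ℓ t → Cyclic R t
cyclic-rotation c rot₀ = c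
cyclic-rotation (ab , bc , ca) rot₁ = bc , ca , ab
cyclic-rotation (ab , bc , ca) rot₂ = ca , ab , bc

Antisymmetric : Relation → Set
Antisymmetric R = ∀ x y → x ⟶[ R ] y → ¬ (y ⟶[ R ] x)

antisym⇒irreflexive : ∀ {R} → Antisymmetric R → ∀ {x y} → x ⟶[ R ] y → x ≢ y
antisym⇒irreflexive antisym x→y refl = antisym _ _ x→y x→y

OffLine : Op₂ Point → Point → Point → Point → Set
OffLine _·_ x y w = w ≢ x × w ≢ y × w ≢ x · y

record IsOrientationOf (_·_ : Op₂ Point) (R : Relation) : Set where
  field
    antisym      : Antisymmetric R
    cyclic       : ∀ x y → x ≢ y → Cyclic R (x , y , x · y) ⊎ Cyclic R (x , x · y , y)
    -- The arguments come in this order so that isOrientationOf? can prune on each arrow.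
    outCollinear : ∀ x y₁ → x ⟶[ R ] y₁ → ∀ y₂ → x ⟶[ R ] y₂ → OffLine _·_ x y₁ y₂ →
                   ∀ y₃ → x ⟶[ R ] y₃ → OffLine _·_ x y₁ y₃ → OffLine _·_ x y₂ y₃ →
                   y₃ ≡ y₁ · y₂

  irreflexive : ∀ {x y} → x ⟶[ R ] y → x ≢ y
  irreflexive = antisym⇒irreflexive antisym

  oriented-line : ∀ {x y} → x ≢ y → Cyclic R (orient (R x y) (x , y , x · y))
  oriented-line {x} {y} x≢y with cyclic x y x≢y
  ... | inj₁ c@(x→y , _) rewrite x→y = c
  ... | inj₂ (x→z , z→y , y→x) rewrite Bool.¬-not (antisym y x y→x) = y→x , x→z , z→y

  reversed-¬arrow : ∀ {ℓ x y z} → Cyclic R ℓ → Rotation (reverse ℓ) (x , y , z) → ¬ (x ⟶[ R ] y)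
  reversed-¬arrow c r = antisym _ _ (proj₁ (cyclic-rotation c (rotation-reverse r)))

_⟶?[_]_ : ∀ x R y → Dec (x ⟶[ R ] y)
x ⟶?[ R ] y = R x y Bool.≟ true

isOrientationOf? : ∀ _·_ R → Dec (IsOrientationOf _·_ R)
isOrientationOf? _·_ R =
  map′ (λ (a , c , o) → record { antisym = a ; cyclic = c ; outCollinear = o })
       (λ O → IsOrientationOf.antisym O , IsOrientationOf.cyclic O , IsOrientationOf.outCollinear O)
       (  all? (λ x → all? λ y → x ⟶?[ R ] y →-dec ¬? (y ⟶?[ R ] x))
   ×-dec all? (λ x → all? λ y → ¬? (x ≟ y) →-dec
           (cyclic? (x , y , x · y) ⊎-dec cyclic? (x , x · y , y)))
   ×-dec all? (λ x → all? λ y₁ → x ⟶?[ R ] y₁ →-dec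
           all? λ y₂ → x ⟶?[ R ] y₂ →-dec offLine? x y₁ y₂ →-dec
           all? λ y₃ → x ⟶?[ R ] y₃ →-dec offLine? x y₁ y₃ →-dec offLine? x y₂ y₃ →-dec
           y₃ ≟ y₁ · y₂))
  where
    cyclic? : ∀ ℓ → Dec (Cyclic R ℓ)
    cyclic? (a , b , c) = a ⟶?[ R ] b ×-dec b ⟶?[ R ] c ×-dec c ⟶?[ R ] a
    offLine? : ∀ x y w → Dec (OffLine _·_ x y w)
    offLine? x y w = ¬? (w ≟ x) ×-dec ¬? (w ≟ y) ×-dec ¬? (w ≟ x · y)

IsOrientationOf-resp : ∀ {_·_ _∙_ R S} → (∀ x y → x · y ≡ x ∙ y) → R ≐ S →
                       IsOrientationOf _·_ R → IsOrientationOf _∙_ S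
IsOrientationOf-resp {_·_} {_∙_} {R} {S} ·≗∙ R≐S O = record
  { antisym      = λ x y x→y y→x → antisym x y (arrow⁻ x→y) (arrow⁻ y→x)
  ; cyclic       = λ x y x≢y → Sum.map cycle cycle
      (subst (λ z → Cyclic R (x , y , z) ⊎ Cyclic R (x , z , y)) (·≗∙ x y) (cyclic x y x≢y))
  ; outCollinear = λ x y₁ x→y₁ y₂ x→y₂ off₁₂ y₃ x→y₃ off₁₃ off₂₃ →
      trans (outCollinear x y₁ (arrow⁻ x→y₁) y₂ (arrow⁻ x→y₂) (offLine off₁₂)
                          y₃ (arrow⁻ x→y₃) (offLine off₁₃) (offLine off₂₃))
            (·≗∙ y₁ y₂)
  }
  where
    open IsOrientationOf O
    arrow⁻ : ∀ {x y} → x ⟶[ S ] y → x ⟶[ R ] y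
    arrow⁻ {x} {y} = trans (R≐S x y)
    cycle : ∀ {ℓ} → Cyclic R ℓ → Cyclic S ℓ
    cycle {a , b , c} (ab , bc , ca) =
      trans (sym (R≐S a b)) ab , trans (sym (R≐S b c)) bc , trans (sym (R≐S c a)) ca
    offLine : ∀ {x y w} → OffLine _∙_ x y w → OffLine _·_ x y w
    offLine {x} {y} (w≢x , w≢y , w≢x∙y) = w≢x , w≢y , w≢x∙y ∘ λ w≡x·y → trans w≡x·y (·≗∙ x y)

relabelOp : Permutation′ 7 → Op₂ Point → Op₂ Point
relabelOp π _·_ x y = π ⟨$⟩ʳ ((π ⟨$⟩ˡ x) · (π ⟨$⟩ˡ y))

relabel : Permutation′ 7 → Relation → Relation
relabel π R x y = R (π ⟨$⟩ˡ x) (π ⟨$⟩ˡ y)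

relabel∘relabel-flip : ∀ π R x y → relabel π (relabel (flip π) R) x y ≡ R x y
relabel∘relabel-flip π R x y = cong₂ R (inverseʳ π) (inverseʳ π)

relabel-flip∘relabel : ∀ π R x y → relabel (flip π) (relabel π R) x y ≡ R x y
relabel-flip∘relabel π R x y = cong₂ R (inverseˡ π) (inverseˡ π)

relabelOp-flip : ∀ π {_·_ _∙_} → (∀ x y → relabelOp π _·_ x y ≡ x ∙ y) →
                 ∀ x y → relabelOp (flip π) _∙_ x y ≡ x · y
relabelOp-flip π {_·_} {_∙_} ·≗∙ x y = begin
  π ⟨$⟩ˡ ((π ⟨$⟩ʳ x) ∙ (π ⟨$⟩ʳ y))
    ≡⟨ cong (π ⟨$⟩ˡ_) (sym (·≗∙ _ _)) ⟩
  π ⟨$⟩ˡ (π ⟨$⟩ʳ ((π ⟨$⟩ˡ (π ⟨$⟩ʳ x)) · (π ⟨$⟩ˡ (π ⟨$⟩ʳ y))))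
    ≡⟨ inverseˡ π ⟩
  (π ⟨$⟩ˡ (π ⟨$⟩ʳ x)) · (π ⟨$⟩ˡ (π ⟨$⟩ʳ y))
    ≡⟨ cong₂ _·_ (inverseˡ π) (inverseˡ π) ⟩
  x · y
    ∎
  where open ≡-Reasoning

⟨$⟩ˡ-injective : ∀ (π : Permutation′ 7) {x y} → π ⟨$⟩ˡ x ≡ π ⟨$⟩ˡ y → x ≡ y
⟨$⟩ˡ-injective π eq = trans (sym (inverseʳ π)) (trans (cong (π ⟨$⟩ʳ_) eq) (inverseʳ π))

IsSteiner-relabel : ∀ π {_·_} → IsSteiner _·_ → IsSteiner (relabelOp π _·_)
IsSteiner-relabel π {_·_} S = record
  { idem       = λ x → trans (cong (π ⟨$⟩ʳ_) (idem (π ⟨$⟩ˡ x))) (inverseʳ π)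
  ; comm       = λ x y → cong (π ⟨$⟩ʳ_) (comm (π ⟨$⟩ˡ x) (π ⟨$⟩ˡ y))
  ; involutive = λ x y → trans (cong (λ z → π ⟨$⟩ʳ ((π ⟨$⟩ˡ x) · z)) (inverseˡ π))
                               (trans (cong (π ⟨$⟩ʳ_) (involutive (π ⟨$⟩ˡ x) (π ⟨$⟩ˡ y))) (inverseʳ π))
  }
  where open IsSteiner S

IsOrientationOf-relabel : ∀ π {_·_ R} → IsOrientationOf _·_ R →
                          IsOrientationOf (relabelOp π _·_) (relabel π R)
IsOrientationOf-relabel π {_·_} {R} O = record
  { antisym      = λ x y → antisym (σ x) (σ y)
  ; cyclic       = λ x y x≢y → subst (λ z → Cyclic R (σ x , σ y , z) ⊎ Cyclic R (σ x , z , σ y))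
                                     (sym (inverseˡ π)) (cyclic (σ x) (σ y) (x≢y ∘ ⟨$⟩ˡ-injective π))
  ; outCollinear = λ x y₁ x→y₁ y₂ x→y₂ off₁₂ y₃ x→y₃ off₁₃ off₂₃ →
      trans (sym (inverseʳ π)) (cong (π ⟨$⟩ʳ_)
        (outCollinear (σ x) (σ y₁) x→y₁ (σ y₂) x→y₂ (offLine off₁₂)
                      (σ y₃) x→y₃ (offLine off₁₃) (offLine off₂₃)))
  }
  where
    open IsOrientationOf O
    σ : Point → Point
    σ = π ⟨$⟩ˡ_
    offLine : ∀ {x y w} → OffLine (relabelOp π _·_) x y w → OffLine _·_ (σ x) (σ y) (σ w)
    offLine (w≢x , w≢y , w≢x·y) =
      w≢x ∘ ⟨$⟩ˡ-injective π , w≢y ∘ ⟨$⟩ˡ-injective π ,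
      λ σw≡σx·σy → w≢x·y (trans (sym (inverseʳ π)) (cong (π ⟨$⟩ʳ_) σw≡σx·σy))

Exactly : ℕ → (Relation → Set) → Set
Exactly n P = Σ (Fin n → Relation) λ o →
  (∀ i → P (o i)) × (∀ i j → i ≢ j → ¬ (o i ≐ o j)) × (∀ R → P R → ∃ λ i → R ≐ o i)

Exactly-⇔ : ∀ {n P Q} → (∀ R → P R ⇔ Q R) → Exactly n P → Exactly n Q
Exactly-⇔ P⇔Q (o , o-valid , o-distinct , o-complete) =
  o , (λ i → Equivalence.to (P⇔Q (o i)) (o-valid i)) , o-distinct ,
  λ R → o-complete R ∘ Equivalence.from (P⇔Q R)

Exactly-relabel : ∀ {n P Q} π →
                  (∀ R → P R → Q (relabel π R)) → (∀ R → Q R → P (relabel (flip π) R)) →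
                  Exactly n P → Exactly n Q
Exactly-relabel π P⇒Q Q⇒P (o , o-valid , o-distinct , o-complete) =
  relabel π ∘ o , (λ i → P⇒Q (o i) (o-valid i)) ,
  (λ i j i≢j πoᵢ≐πoⱼ → o-distinct i j i≢j λ x y →
     trans (sym (relabel-flip∘relabel π (o i) x y))
           (trans (πoᵢ≐πoⱼ _ _) (relabel-flip∘relabel π (o j) x y))) ,
  λ R QR → let i , R′≐oᵢ = o-complete _ (Q⇒P R QR) in
    i , λ x y → trans (sym (relabel∘relabel-flip π R x y)) (R′≐oᵢ _ _)

-- The Steiner quasigroup of a Fano plane

triple : Point → Point → Point → Subset 7
triple x y z = ⁅ x ⁆ ∪ ⁅ y ⁆ ∪ ⁅ z ⁆

∈-triple⁻ : ∀ {w x y z} → w ∈ triple x y z → w ≡ x ⊎ w ≡ y ⊎ w ≡ z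
∈-triple⁻ {x = x} {y} {z} w∈ with x∈p∪q⁻ ⁅ x ⁆ _ w∈
... | inj₁ w∈x = inj₁ (x∈⁅y⁆⇒x≡y x w∈x)
... | inj₂ w∈yz with x∈p∪q⁻ ⁅ y ⁆ _ w∈yz
...   | inj₁ w∈y = inj₂ (inj₁ (x∈⁅y⁆⇒x≡y y w∈y))
...   | inj₂ w∈z = inj₂ (inj₂ (x∈⁅y⁆⇒x≡y z w∈z))

∈-triple₁ : ∀ x y z → x ∈ triple x y z
∈-triple₁ x y z = x∈p∪q⁺ (inj₁ (x∈⁅x⁆ x))

∈-triple₂ : ∀ x y z → y ∈ triple x y z
∈-triple₂ x y z = x∈p∪q⁺ {p = ⁅ x ⁆} (inj₂ (x∈p∪q⁺ (inj₁ (x∈⁅x⁆ y))))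

∈-triple₃ : ∀ x y z → z ∈ triple x y z
∈-triple₃ x y z = x∈p∪q⁺ {p = ⁅ x ⁆} (inj₂ (x∈p∪q⁺ {p = ⁅ y ⁆} (inj₂ (x∈⁅x⁆ z))))

abstract
  ∣p∣≡3⇒p≡triple : ∀ p x y → ∣ p ∣ ≡ 3 → x ∈ p → y ∈ p → x ≢ y →
                   ∃ λ z → z ≢ x × z ≢ y × p ≡ triple x y z
  ∣p∣≡3⇒p≡triple = from-yes (all-subsets? λ p → all? λ x → all? λ y →
    ∣ p ∣ ℕ.≟ 3 →-dec x ∈? p →-dec y ∈? p →-dec ¬? (x ≟ y) →-dec
    any? λ z → ¬? (z ≟ x) ×-dec ¬? (z ≟ y) ×-dec Vec.≡-dec Bool._≟_ p (triple x y z))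

module FanoPlane {B : Blocks} (F : IsFanoPlane B) where
  open IsFanoPlane F

  record IsThirdPoint (x y z : Point) : Set where
    field
      triple∈B : B (triple x y z)
      ≢ˡ       : z ≢ x
      ≢ʳ       : z ≢ y
      unique   : ∀ b → B b → x ∈ b → y ∈ b → b ≡ triple x y z

  third : ∀ x y → x ≢ y → ∃ (IsThirdPoint x y)
  third x y x≢y =
    let b , b∈B , x∈b , y∈b , b-unique = uniqueBlock x y x≢y
        z , z≢x , z≢y , b≡xyz = ∣p∣≡3⇒p≡triple b x y (blockSize b b∈B) x∈b y∈b x≢y
    in z , record { triple∈B = subst B b≡xyz b∈B ; ≢ˡ = z≢x ; ≢ʳ = z≢y
                  ; unique = λ b′ b′∈B x∈b′ y∈b′ → trans (b-unique b′ b′∈B x∈b′ y∈b′) b≡xyz }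

  _·_ : Op₂ Point
  x · y with x ≟ y
  ... | yes _   = x
  ... | no x≢y = proj₁ (third x y x≢y)

  ·-third : ∀ {x y} → x ≢ y → IsThirdPoint x y (x · y)
  ·-third {x} {y} x≢y with x ≟ y
  ... | yes x≡y  = contradiction x≡y x≢y
  ... | no x≢y′ = proj₂ (third x y x≢y′)

  line : Point → Point → Subset 7
  line x y = triple x y (x · y)

  line∈B : ∀ {x y} → x ≢ y → B (line x y)
  line∈B x≢y = IsThirdPoint.triple∈B (·-third x≢y)

  line-unique : ∀ {x y b} → x ≢ y → B b → x ∈ b → y ∈ b → b ≡ line x y
  line-unique x≢y = IsThirdPoint.unique (·-third x≢y) _

  on-line : ∀ {x y w b} → x ≢ y → B b → x ∈ b → y ∈ b → w ∈ b → w ≢ x → w ≢ y → w ≡ x · y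
  on-line {w = w} x≢y b∈B x∈b y∈b w∈b w≢x w≢y
    with ∈-triple⁻ (subst (w ∈_) (line-unique x≢y b∈B x∈b y∈b) w∈b)
  ... | inj₁ w≡x        = contradiction w≡x w≢x
  ... | inj₂ (inj₁ w≡y) = contradiction w≡y w≢y
  ... | inj₂ (inj₂ w≡z) = w≡z

  isSteiner : IsSteiner _·_
  isSteiner = record { idem = idem ; comm = comm ; involutive = involutive }
    where
      idem : ∀ x → x · x ≡ x
      idem x with x ≟ x
      ... | yes _  = refl
      ... | no x≢x = contradiction refl x≢x
      comm : ∀ x y → x · y ≡ y · x
      comm x y with toSum (x ≟ y)
      ... | inj₁ refl = refl
      ... | inj₂ x≢y  = let open IsThirdPoint (·-third (x≢y ∘ sym)) in
        sym (on-line x≢y triple∈B (∈-triple₂ y x _) (∈-triple₁ y x _) (∈-triple₃ y x _) ≢ʳ ≢ˡ)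
      involutive : ∀ x y → x · (x · y) ≡ y
      involutive x y with toSum (x ≟ y)
      ... | inj₁ refl = trans (cong (x ·_) (idem x)) (idem x)
      ... | inj₂ x≢y  = let open IsThirdPoint (·-third x≢y) in
        sym (on-line (≢ˡ ∘ sym) triple∈B (∈-triple₁ x y _) (∈-triple₃ x y _) (∈-triple₂ x y _)
                     (x≢y ∘ sym) (≢ʳ ∘ sym))

  off-line⇒line≢ : ∀ {x y w} → OffLine _·_ x y w → line x y ≢ line x w
  off-line⇒line≢ {x} {y} {w} (w≢x , w≢y , w≢x·y) eq
    with ∈-triple⁻ (subst (w ∈_) (sym eq) (∈-triple₂ x w _))
  ... | inj₁ w≡x          = w≢x w≡x
  ... | inj₂ (inj₁ w≡y)   = w≢y w≡y
  ... | inj₂ (inj₂ w≡x·y) = w≢x·y w≡x·y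

  line≢⇒off-line : ∀ {x y w} → x ≢ y → x ≢ w → line x y ≢ line x w → OffLine _·_ x y w
  line≢⇒off-line {x} {y} {w} x≢y x≢w ≢ =
    x≢w ∘ sym , (≢ ∘ λ { refl → refl }) ,
    λ w≡x·y → ≢ (line-unique x≢w (line∈B x≢y) (∈-triple₁ x y _)
                             (subst (_∈ line x y) (sym w≡x·y) (∈-triple₃ x y _)))

  IsOrientation⇒IsOrientationOf : ∀ {R} → IsOrientation B R → IsOrientationOf _·_ R
  IsOrientation⇒IsOrientationOf {R} O = record
    { antisym      = antisym
    ; cyclic       = λ x y x≢y → let open IsThirdPoint (·-third x≢y) in
        cyclic (line x y) (line∈B x≢y) x y (x · y) (∈-triple₁ x y _) (∈-triple₂ x y _) (∈-triple₃ x y _)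
               x≢y (≢ʳ ∘ sym) (≢ˡ ∘ sym)
    ; outCollinear = λ x y₁ x→y₁ y₂ x→y₂ off₁₂ y₃ x→y₃ off₁₃ off₂₃ →
        on-line (proj₁ (proj₂ off₁₂) ∘ sym)
          (outBlock x y₁ y₂ y₃ (line x y₁) (line x y₂) (line x y₃)
             (line∈B (irreflexive x→y₁)) (line∈B (irreflexive x→y₂)) (line∈B (irreflexive x→y₃))
             (∈-triple₁ x y₁ _) (∈-triple₁ x y₂ _) (∈-triple₁ x y₃ _)
             (off-line⇒line≢ off₁₂) (off-line⇒line≢ off₂₃) (off-line⇒line≢ off₁₃)
             (∈-triple₂ x y₁ _) (∈-triple₂ x y₂ _) (∈-triple₂ x y₃ _) x→y₁ x→y₂ x→y₃)
          (∈-triple₁ y₁ y₂ y₃) (∈-triple₂ y₁ y₂ y₃) (∈-triple₃ y₁ y₂ y₃)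
          (proj₁ (proj₂ off₁₃)) (proj₁ (proj₂ off₂₃))
    }
    where
      open IsOrientation O
      irreflexive : ∀ {x y} → x ⟶[ R ] y → x ≢ y
      irreflexive = antisym⇒irreflexive antisym

  IsOrientationOf⇒IsOrientation : ∀ {R} → IsOrientationOf _·_ R → IsOrientation B R
  IsOrientationOf⇒IsOrientation {R} O = record
    { antisym  = antisym
    ; cyclic   = λ b b∈B x₁ x₂ x₃ x₁∈b x₂∈b x₃∈b x₁≢x₂ x₂≢x₃ x₁≢x₃ →
        subst (λ z → Cyclic R (x₁ , x₂ , z) ⊎ Cyclic R (x₁ , z , x₂))
              (sym (on-line x₁≢x₂ b∈B x₁∈b x₂∈b x₃∈b (x₁≢x₃ ∘ sym) (x₂≢x₃ ∘ sym)))
              (cyclic x₁ x₂ x₁≢x₂)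
    ; outBlock = λ x y₁ y₂ y₃ b₁ b₂ b₃ b₁∈B b₂∈B b₃∈B x∈b₁ x∈b₂ x∈b₃ b₁≢b₂ b₂≢b₃ b₁≢b₃
                   y₁∈b₁ y₂∈b₂ y₃∈b₃ x→y₁ x→y₂ x→y₃ →
        let b₁≡ = line-unique (irreflexive x→y₁) b₁∈B x∈b₁ y₁∈b₁
            b₂≡ = line-unique (irreflexive x→y₂) b₂∈B x∈b₂ y₂∈b₂
            b₃≡ = line-unique (irreflexive x→y₃) b₃∈B x∈b₃ y₃∈b₃
            off₁₂ = off-line x→y₁ x→y₂ b₁≡ b₂≡ b₁≢b₂
        in subst (λ y → B (triple y₁ y₂ y))
             (sym (outCollinear x y₁ x→y₁ y₂ x→y₂ off₁₂
                                y₃ x→y₃ (off-line x→y₁ x→y₃ b₁≡ b₃≡ b₁≢b₃)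
                                        (off-line x→y₂ x→y₃ b₂≡ b₃≡ b₂≢b₃)))
             (line∈B (proj₁ (proj₂ off₁₂) ∘ sym))
    }
    where
      open IsOrientationOf O
      off-line : ∀ {x yᵢ yⱼ bᵢ bⱼ} → x ⟶[ R ] yᵢ → x ⟶[ R ] yⱼ → bᵢ ≡ line x yᵢ → bⱼ ≡ line x yⱼ →
                 bᵢ ≢ bⱼ → OffLine _·_ x yᵢ yⱼ
      off-line x→yᵢ x→yⱼ refl refl = line≢⇒off-line (irreflexive x→yᵢ) (irreflexive x→yⱼ)

  orientation⇔ : ∀ R → IsOrientationOf _·_ R ⇔ IsOrientation B R
  orientation⇔ R = mk⇔ IsOrientationOf⇒IsOrientation IsOrientation⇒IsOrientationOf

-- The model 𝔽₂³ ∖ {0}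

Vector : Set
Vector = Bool × Bool × Bool

-- Point i is the nonzero vector whose binary expansion is i + 1.
coordinates : Point → Vector
coordinates 0F = false , false , true
coordinates 1F = false , true  , false
coordinates 2F = false , true  , true
coordinates 3F = true  , false , false
coordinates 4F = true  , false , true
coordinates 5F = true  , true  , false
coordinates 6F = true  , true  , true

-- The value at the zero vector is junk; fano only uses point on a sum x + y with x ≢ y.
point : Vector → Point
point (false , false , true ) = 0F
point (false , true  , false) = 1F
point (false , true  , true ) = 2F
point (true  , false , false) = 3F
point (true  , false , true ) = 4F
point (true  , true  , false) = 5F
point (true  , true  , true ) = 6F
point (false , false , false) = 0F

_+ᵥ_ : Vector → Vector → Vector
(a , b , c) +ᵥ (a′ , b′ , c′) = a xor a′ , b xor b′ , c xor c′

fano : Op₂ Point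
fano x y with x ≟ y
... | yes _ = x
... | no  _ = point (coordinates x +ᵥ coordinates y)

fanoLine : Fin 7 → Triple
fanoLine 0F = 0F , 1F , 2F
fanoLine 1F = 0F , 3F , 4F
fanoLine 2F = 1F , 3F , 5F
fanoLine 3F = 2F , 3F , 6F
fanoLine 4F = 0F , 5F , 6F
fanoLine 5F = 1F , 4F , 6F
fanoLine 6F = 2F , 4F , 5F

abstract
  fano-idem : ∀ x → fano x x ≡ x
  fano-idem = from-yes (all? λ x → fano x x ≟ x)

  fano-covered : ∀ x y → x ≢ y → ∃ λ i → Ordering (fanoLine i) (x , y , fano x y)
  fano-covered = from-yes (all? λ x → all? λ y → ¬? (x ≟ y) →-dec
    any? λ i → ordering? (fanoLine i) (x , y , fano x y))

eliminates? : ∀ known x y z → Dec (∀ w → w ≢ z → w ≢ x → w ≢ y → Excluded known x y w)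
eliminates? known x y z =
  all? λ w → ¬? (w ≟ z) →-dec ¬? (w ≟ x) →-dec ¬? (w ≟ y) →-dec excluded? known x y w

module Rigidity {_·_} (S : IsSteiner _·_)
                (01≡2 : 0F · 1F ≡ 2F) (03≡4 : 0F · 3F ≡ 4F) (13≡5 : 1F · 3F ≡ 5F) where
  open IsSteiner S

  known : List Triple
  known = fanoLine 0F ∷ fanoLine 1F ∷ fanoLine 2F ∷ []

  known-closed : All (Closed _·_) known
  known-closed = 01≡2 ∷ 03≡4 ∷ 13≡5 ∷ []

  fanoLine-closed : ∀ i → Closed _·_ (fanoLine i)
  fanoLine-closed 0F = 01≡2
  fanoLine-closed 1F = 03≡4
  fanoLine-closed 2F = 13≡5
  fanoLine-closed 3F = trans (comm 2F 3F)
    (third-by-elimination known-closed (λ ()) (from-yes (eliminates? known 3F 2F 6F)))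
  fanoLine-closed 4F = third-by-elimination known-closed (λ ()) (from-yes (eliminates? known 0F 5F 6F))
  fanoLine-closed 5F = third-by-elimination known-closed (λ ()) (from-yes (eliminates? known 1F 4F 6F))
  fanoLine-closed 6F = third-by-elimination (fanoLine-closed 3F ∷ known-closed) (λ ())
    (from-yes (eliminates? (fanoLine 3F ∷ known) 2F 4F 5F))

  ≗fano : ∀ x y → x · y ≡ fano x y
  ≗fano x y with toSum (x ≟ y)
  ... | inj₁ refl = trans (idem x) (sym (fano-idem x))
  ... | inj₂ x≢y  = let i , o = fano-covered x y x≢y in closed-ordering (fanoLine-closed i) o

-- Bit i of a pattern says whether line i is cycled as listed or reversed.
Pattern : Set
Pattern = Vec Bool 7

direction : Relation → Triple → Bool
direction R (a , b , _) = R a b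

patternOf : Relation → Pattern
patternOf R = tabulate (direction R ∘ fanoLine)

Arrow : Pattern → Point → Point → Set
Arrow v x y = ∃ λ i → Rotation (orient (lookup v i) (fanoLine i)) (x , y , fano x y)

arrow? : ∀ v x y → Dec (Arrow v x y)
arrow? v x y = any? λ i → rotation? (orient (lookup v i) (fanoLine i)) (x , y , fano x y)

orientationOf : Pattern → Relation
orientationOf v x y = does (arrow? v x y)

module _ {R} (O : IsOrientationOf fano R) where
  open IsOrientationOf O

  fanoLine-oriented : ∀ i → Cyclic R (orient (lookup (patternOf R) i) (fanoLine i))
  fanoLine-oriented i =
    subst (λ s → Cyclic R (orient s (fanoLine i)))
          (sym (Vec.lookup∘tabulate (direction R ∘ fanoLine) i)) (oriented i)
    where
      oriented : ∀ i → Cyclic R (orient (direction R (fanoLine i)) (fanoLine i))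
      oriented 0F = oriented-line (λ ())
      oriented 1F = oriented-line (λ ())
      oriented 2F = oriented-line (λ ())
      oriented 3F = oriented-line (λ ())
      oriented 4F = oriented-line (λ ())
      oriented 5F = oriented-line (λ ())
      oriented 6F = oriented-line (λ ())

  arrow⇒⟶ : ∀ {x y} → Arrow (patternOf R) x y → x ⟶[ R ] y
  arrow⇒⟶ (i , r) = proj₁ (cyclic-rotation (fanoLine-oriented i) r)

  ⟶⇒arrow : ∀ {x y} → x ⟶[ R ] y → Arrow (patternOf R) x y
  ⟶⇒arrow {x} {y} x→y with fano-covered x y (irreflexive x→y)
  ... | i , o with ordering-orient (lookup (patternOf R) i) o
  ...   | inj₁ r = i , r
  ...   | inj₂ r = contradiction x→y (reversed-¬arrow (fanoLine-oriented i) r)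

  ≐orientationOf-patternOf : R ≐ orientationOf (patternOf R)
  ≐orientationOf-patternOf x y = by-decision (arrow? (patternOf R) x y)
    where
      by-decision : (arrow? : Dec (Arrow (patternOf R) x y)) → R x y ≡ does arrow?
      by-decision (yes arrow) = arrow⇒⟶ arrow
      by-decision (no ¬arrow) = Bool.¬-not (¬arrow ∘ ⟶⇒arrow)

patterns : Vec Pattern 8
patterns = (false ∷ false ∷ false ∷ false ∷ true  ∷ false ∷ true  ∷ [])
         ∷ (false ∷ false ∷ true  ∷ true  ∷ true  ∷ true  ∷ false ∷ [])
         ∷ (false ∷ true  ∷ false ∷ true  ∷ false ∷ false ∷ false ∷ [])
         ∷ (false ∷ true  ∷ true  ∷ false ∷ false ∷ true  ∷ true  ∷ [])
         ∷ (true  ∷ false ∷ false ∷ false ∷ false ∷ true  ∷ false ∷ [])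
         ∷ (true  ∷ false ∷ true  ∷ true  ∷ false ∷ false ∷ true  ∷ [])
         ∷ (true  ∷ true  ∷ false ∷ true  ∷ true  ∷ true  ∷ true  ∷ [])
         ∷ (true  ∷ true  ∷ true  ∷ false ∷ true  ∷ false ∷ false ∷ [])
         ∷ []

fanoOrientation : Fin 8 → Relation
fanoOrientation i = orientationOf (lookup patterns i)

_≐?_ : ∀ R S → Dec (R ≐ S)
R ≐? S = all? λ x → all? λ y → R x y Bool.≟ S x y

abstract
  fanoOrientation-valid : ∀ i → IsOrientationOf fano (fanoOrientation i)
  fanoOrientation-valid = from-yes (all? λ i → isOrientationOf? fano (fanoOrientation i))

  fanoOrientation-distinct : ∀ i j → i ≢ j → ¬ (fanoOrientation i ≐ fanoOrientation j)
  fanoOrientation-distinct = from-yes (all? λ i → all? λ j →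
    ¬? (i ≟ j) →-dec ¬? (fanoOrientation i ≐? fanoOrientation j))

  consistent-pattern : ∀ v → IsOrientationOf fano (orientationOf v) → ∃ λ i → v ≡ lookup patterns i
  consistent-pattern = from-yes (all-subsets? λ v →
    isOrientationOf? fano (orientationOf v) →-dec any? λ i → Vec.≡-dec Bool._≟_ v (lookup patterns i))

fano-orientations : Exactly 8 (IsOrientationOf fano)
fano-orientations = fanoOrientation , fanoOrientation-valid , fanoOrientation-distinct , complete
  where
    complete : ∀ R → IsOrientationOf fano R → ∃ λ i → R ≐ fanoOrientation i
    complete R O =
      let R≐ = ≐orientationOf-patternOf O
          i , v≡ = consistent-pattern (patternOf R) (IsOrientationOf-resp (λ _ _ → refl) R≐ O)
      in i , λ x y → trans (R≐ x y) (cong (λ v → orientationOf v x y) v≡)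

-- Isomorphism with the model

abstract
  fourth-point : ∀ (a : Point) → ∃ λ d → d ≢ 0F × d ≢ 1F × d ≢ a
  fourth-point = from-yes (all? λ (a : Point) → any? λ (d : Point) →
    ¬? (d ≟ 0F) ×-dec ¬? (d ≟ 1F) ×-dec ¬? (d ≟ a))

module Normalisation {_·_} (S : IsSteiner _·_) where
  open IsSteiner S

  a : Point
  a = 0F · 1F

  d : Point
  d = proj₁ (fourth-point a)

  d≢0 : d ≢ 0F
  d≢0 = proj₁ (proj₂ (fourth-point a))

  d≢1 : d ≢ 1F
  d≢1 = proj₁ (proj₂ (proj₂ (fourth-point a)))

  d≢a : d ≢ a
  d≢a = proj₂ (proj₂ (proj₂ (fourth-point a)))

  frame : Vec Point 7
  frame = 0F ∷ 1F ∷ a ∷ d ∷ 0F · d ∷ 1F · d ∷ a · d ∷ []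

  -- 0 · d, 1 · d, a · d are distinct as u ↦ u · d is injective, and none lies on the line
  -- {0, 1, a}: u · d ≡ v would force d ≡ u · v.
  frame-unique : Unique frame
  frame-unique =
      ((λ ()) ∷ ≢-sym a≢0 ∷ ≢-sym d≢0 ∷ ≢-sym (·-≢ˡ (≢-sym d≢0))
              ∷ ≢-sym (exchange-≢ 1·0≡a d≢a) ∷ ≢-sym (exchange-≢ a·0≡1 d≢1) ∷ [])
    ∷ (≢-sym a≢1 ∷ ≢-sym d≢1 ∷ ≢-sym (exchange-≢ refl d≢a)
                 ∷ ≢-sym (·-≢ˡ (≢-sym d≢1)) ∷ ≢-sym (exchange-≢ a·1≡0 d≢0) ∷ [])
    ∷ (≢-sym d≢a ∷ ≢-sym (exchange-≢ 0·a≡1 d≢1)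
                 ∷ ≢-sym (exchange-≢ 1·a≡0 d≢0) ∷ ≢-sym (·-≢ˡ (≢-sym d≢a)) ∷ [])
    ∷ (≢-sym (·-≢ʳ (≢-sym d≢0)) ∷ ≢-sym (·-≢ʳ (≢-sym d≢1)) ∷ ≢-sym (·-≢ʳ (≢-sym d≢a)) ∷ [])
    ∷ ((λ ()) ∘ ·-cancelʳ ∷ ≢-sym a≢0 ∘ ·-cancelʳ ∷ [])
    ∷ (≢-sym a≢1 ∘ ·-cancelʳ ∷ [])
    ∷ [] ∷ []
    where
      a≢0 : a ≢ 0F
      a≢0 = ·-≢ˡ (λ ())
      a≢1 : a ≢ 1F
      a≢1 = ·-≢ʳ (λ ())
      0·a≡1 : 0F · a ≡ 1F
      0·a≡1 = exchange refl
      1·0≡a : 1F · 0F ≡ a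
      1·0≡a = comm 1F 0F
      1·a≡0 : 1F · a ≡ 0F
      1·a≡0 = exchange 1·0≡a
      a·0≡1 : a · 0F ≡ 1F
      a·0≡1 = trans (comm a 0F) 0·a≡1
      a·1≡0 : a · 1F ≡ 0F
      a·1≡0 = trans (comm a 1F) 1·a≡0

  π : Permutation′ 7
  π = flip (injective⇒permutation (lookup frame) (lookup-injective frame-unique _ _))

  open Rigidity (IsSteiner-relabel π S) (inverseʳ π) (inverseʳ π) (inverseʳ π) public using (≗fano)

steiner-orientations : ∀ {_·_} → IsSteiner _·_ → Exactly 8 (IsOrientationOf _·_)
steiner-orientations S = Exactly-relabel (flip π)
  (λ _ → IsOrientationOf-resp (relabelOp-flip π ≗fano) (λ _ _ → refl) ∘ IsOrientationOf-relabel (flip π))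
  (λ _ → IsOrientationOf-resp ≗fano (λ _ _ → refl) ∘ IsOrientationOf-relabel π)
  fano-orientations
  where open Normalisation S

corollary3p3 : (B : Blocks) → IsFanoPlane B →
    Σ (Fin 8 → Relation) λ o →
    (∀ i → IsOrientation B (o i)) ×
    (∀ i j → i ≢ j → ¬ (o i ≐ o j)) ×
    (∀ R → IsOrientation B R → ∃ λ i → R ≐ o i)
corollary3p3 B F = Exactly-⇔ orientation⇔ (steiner-orientations isSteiner)
  where open FanoPlane F
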